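{- Let $P$ be a set of forbidden patterns as described in the context, and let $q\ge0$. If a word $\sigma$ is a $q$-chain (for $P$), then no proper prefix of $\sigma$ (i.e. no word $\rho$ with $\sigma=\rho\nu$, $\nu$ nonempty) is a $q$-chain.
   Context: $P$ is a set of permutations (patterns), each of length at least $2$, forming an antichain: no pattern of $P$ occurs as a consecutive pattern in another pattern of $P$. Words are finite sequences of pairwise distinct elements of a totally ordered set (e.g. integers). For a word $s=s_1\dots s_k$, $\mathrm{st}(s)$ is the permutation $\pi$ of $\{1,\dots,k\}$ with $s_i<s_j\iff\pi_i<\pi_j$. An occurrence of a pattern $\pi$ of length $j$ in a word $w=w_1\dots w_r$ is a factor $w_i\dots w_{i+j-1}$ with $\mathrm{st}(w_i\dots w_{i+j-1})=\pi$. Chains and their tails are defined recursively: the empty word is a $0$-chain and is its own tail; every one-letter word is a $1$-chain and is its own tail; for $q\ge2$, a $q$-chain is a word $\sigma$ together with a factorization $\sigma=\sigma'\tau$ such that $\sigma'$ is a $(q-1)$-chain, and, denoting by $\tau'$ the tail of $\sigma'$, the word $\tau'\tau$ contains exactly one occurrence of a pattern from $P$, and this occurrence is a terminal segment (suffix) of $\tau'\tau$; the word $\tau$ is then the tail of $\sigma$. A word "is a $q$-chain" if it admits such a structure. -}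

module Defs where

open import Level using (Level; _⊔_)
open import Data.Nat using (ℕ; zero; suc; _≤_)
import Data.Nat as ℕ
open import Data.Fin using (Fin; cast)
open import Data.List using (List; []; _∷_; _++_; length; lookup; upTo; map)
open import Data.List.Relation.Binary.Permutation.Propositional using (_↭_)
open import Data.List.Relation.Unary.AllPairs using (AllPairs)
open import Data.Product using (Σ; ∃; _×_; _,_)
open import Relation.Binary.PropositionalEquality using (_≡_)
open import Relation.Binary.Bundles using (StrictTotalOrder)
open import Relation.Nullary using (¬_)
open import Function.Bundles using (_⇔_)

-- Order-isomorphism of two lists ("st(w) = st(π)"):
-- same length and w_i < w_j ⟺ π_i < π_j for all positions i, j.
OrderIso : ∀ {a b ℓ ℓ'} {A : Set a} {B : Set b} →
           (A → A → Set ℓ) → (B → B → Set ℓ') → List A → List B → Set (ℓ ⊔ ℓ')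
OrderIso _<A_ _<B_ w π =
  Σ (length w ≡ length π) λ eq →
    ∀ (i j : Fin (length w)) →
      (lookup w i <A lookup w j) ⇔ (lookup π (cast eq i) <B lookup π (cast eq j))

IsPermutation : List ℕ → Set
IsPermutation π = π ↭ map suc (upTo (length π))

OccursIn : List ℕ → List ℕ → Set
OccursIn π ρ = ∃ λ u → ∃ λ f → ∃ λ v → ρ ≡ u ++ f ++ v × OrderIso ℕ._<_ ℕ._<_ f π

ValidPatternSet : (List ℕ → Set) → Set
ValidPatternSet P =
  (∀ π → P π → IsPermutation π × 2 ≤ length π) ×
  (∀ π ρ → P π → P ρ → OccursIn π ρ → π ≡ ρ)

module WithOrder {a ℓ₁ ℓ₂} (O : StrictTotalOrder a ℓ₁ ℓ₂) (P : List ℕ → Set) where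
  open StrictTotalOrder O renaming (Carrier to X)

  Word : Set a
  Word = List X

  Distinct : Word → Set (a ⊔ ℓ₁)
  Distinct = AllPairs (λ x y → ¬ (x ≈ y))

  IsOcc : Word → Set (ℓ₂)
  IsOcc f = ∃ λ π → P π × OrderIso _<_ ℕ._<_ f π

  UniqueSuffixOcc : Word → Set (a ⊔ ℓ₂)
  UniqueSuffixOcc w =
    ∃ λ u → ∃ λ f → w ≡ u ++ f × IsOcc f ×
      (∀ u' f' m → w ≡ u' ++ f' ++ m → IsOcc f' → m ≡ [] × length u' ≡ length u)

  -- Chain q σ τ : σ is a q-chain with tail τ
  data Chain : ℕ → Word → Word → Set (a ⊔ ℓ₂) where
    chain0 : Chain 0 [] []
    chain1 : ∀ x → Chain 1 (x ∷ []) (x ∷ [])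
    chainS : ∀ {n σ' τ' τ} → Chain (suc n) σ' τ' → UniqueSuffixOcc (τ' ++ τ) →
             Chain (suc (suc n)) (σ' ++ τ) τ

  IsChain : ℕ → Word → Set (a ⊔ ℓ₂)
  IsChain q σ = ∃ λ τ → Chain q σ τ

module Submission where

-- We prove a stronger, symmetric rigidity statement by
-- induction on the chain structure: if σ is an n-chain with tail τ, ρ is an
-- n-chain with tail κ, and σ = ρ ν, then ν is empty and τ = κ.  In the
-- inductive step σ = σ' τ and ρ = ρ' κ; by equidivisibility of words one of
-- σ', ρ' is a prefix of the other, so the induction hypothesis (applied in the
-- appropriate direction) shows σ' = ρ' with the same tail τ'.  Then τ' τ and
-- τ' κ both end with an occurrence of a pattern of P, while τ' τ = τ' κ ν
-- contains exactly one occurrence, which is terminal; hence ν is empty.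

open import Defs
open import Data.Nat using (ℕ)
open import Data.List using (List; []; _∷_; _++_)
open import Data.List.Properties using (++-assoc; ++-identityʳ; ∷-injective)
open import Data.Product using (∃; _×_; _,_; proj₁)
open import Data.Sum using (_⊎_; inj₁; inj₂)
open import Relation.Binary.PropositionalEquality
  using (_≡_; _≢_; refl; sym; trans; cong; module ≡-Reasoning)
open import Relation.Binary.Bundles using (StrictTotalOrder)
open import Relation.Nullary using (¬_)

++-equidivisible : ∀ {a} {A : Set a} (x y z w : List A) → x ++ y ≡ z ++ w →
  ∃ λ v → (x ≡ z ++ v × w ≡ v ++ y) ⊎ (z ≡ x ++ v × y ≡ v ++ w)
++-equidivisible []      y z       w e = z , inj₂ (refl , e)
++-equidivisible (a ∷ x) y []      w e = a ∷ x , inj₁ (refl , sym e)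
++-equidivisible (a ∷ x) y (b ∷ z) w e with ∷-injective e
... | refl , e′ with ++-equidivisible x y z w e′
...   | v , inj₁ (x≡zv , w≡vy) = v , inj₁ (cong (a ∷_) x≡zv , w≡vy)
...   | v , inj₂ (z≡xv , y≡vw) = v , inj₂ (cong (a ∷_) z≡xv , y≡vw)

module ChainRigidity {a ℓ₁ ℓ₂} (O : StrictTotalOrder a ℓ₁ ℓ₂) (P : List ℕ → Set) where
  open WithOrder O P

  -- If w has exactly one occurrence of a pattern of P and it is terminal, then
  -- no proper prefix v of w ends with an occurrence: the prefix's terminal
  -- occurrence is also an occurrence in w, so it must reach the end of w.
  uniqueSuffixOcc-noProperPrefix : ∀ (v ν : Word) →
    UniqueSuffixOcc (v ++ ν) → UniqueSuffixOcc v → ν ≡ []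
  uniqueSuffixOcc-noProperPrefix v ν (_ , _ , _ , _ , unique) (u , f , v≡uf , occ , _) =
    proj₁ (unique u f ν vν≡ufν occ)
    where
    open ≡-Reasoning
    vν≡ufν : v ++ ν ≡ u ++ f ++ ν
    vν≡ufν = begin
      v ++ ν         ≡⟨ cong (_++ ν) v≡uf ⟩
      (u ++ f) ++ ν  ≡⟨ ++-assoc u f ν ⟩
      u ++ f ++ ν    ∎

  tail-rigid : ∀ (τ′ τ κ ν : Word) →
    UniqueSuffixOcc (τ′ ++ τ) → UniqueSuffixOcc (τ′ ++ κ) →
    τ ≡ κ ++ ν → ν ≡ [] × τ ≡ κ
  tail-rigid τ′ τ κ ν occτ occκ refl rewrite sym (++-assoc τ′ κ ν)
    with uniqueSuffixOcc-noProperPrefix (τ′ ++ κ) ν occτ occκ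
  ... | refl = refl , ++-identityʳ κ

  chain-prefix-rigid : ∀ {n σ τ ρ κ ν} →
    Chain n σ τ → Chain n ρ κ → σ ≡ ρ ++ ν → ν ≡ [] × τ ≡ κ
  chain-prefix-rigid {ν = []}    chain0     chain0     _  = refl , refl
  chain-prefix-rigid {ν = _ ∷ _} chain0     chain0     ()
  chain-prefix-rigid {ν = []}    (chain1 _) (chain1 _) refl = refl , refl
  chain-prefix-rigid {ν = _ ∷ _} (chain1 _) (chain1 _) ()
  chain-prefix-rigid {ν = ν}
    (chainS {σ' = σ′} {τ' = τ′} {τ = τ} c occτ) (chainS {σ' = ρ′} {τ = κ} d occκ) σ≡ρν
    with ++-equidivisible σ′ τ ρ′ (κ ++ ν) (trans σ≡ρν (++-assoc ρ′ κ ν))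
  ... | v , inj₁ (σ′≡ρ′v , κν≡vτ) with chain-prefix-rigid c d σ′≡ρ′v
  ...   | refl , refl = tail-rigid τ′ τ κ ν occτ occκ (sym κν≡vτ)
  chain-prefix-rigid {ν = ν}
    (chainS {τ' = τ′} {τ = τ} c occτ) (chainS {τ = κ} d occκ) _
      | v , inj₂ (ρ′≡σ′v , τ≡vκν) with chain-prefix-rigid d c ρ′≡σ′v
  ...   | refl , refl = tail-rigid τ′ τ κ ν occτ occκ τ≡vκν

lemma4p1 : ∀ {a ℓ₁ ℓ₂} (O : StrictTotalOrder a ℓ₁ ℓ₂) (P : List ℕ → Set) →
    ValidPatternSet P → (q : ℕ) (σ ρ ν : List (StrictTotalOrder.Carrier O)) →
    WithOrder.Distinct O P σ → σ ≡ ρ ++ ν → ν ≢ [] →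
    WithOrder.IsChain O P q σ → ¬ WithOrder.IsChain O P q ρ
lemma4p1 O P _ q σ ρ ν _ σ≡ρν ν≢[] (τ , σ-chain) (κ , ρ-chain) =
  ν≢[] (proj₁ (ChainRigidity.chain-prefix-rigid O P σ-chain ρ-chain σ≡ρν))
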